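{- Let $S$ be a lattice of finite length, let $(L_x)_{x\in S}$ be lattices of finite length, and let $(\phi_{yx})_{x\le y}$ be partial maps such that the system is $S$-connected. Form the quotient $K/{\sim}$ and the maps $\pi_x:L_x\to K/{\sim}$ as described in the context. Then: - every $\pi_x$ is injective, so that with $L^\pi_x:=\pi_x(L_x)$ carrying the lattice structure transported from $L_x$ along $\pi_x$, each $\pi_x:L_x\to L^\pi_x$ is a lattice isomorphism; - the family $(L^\pi_x)_{x\in S}$ of subsets of $K/{\sim}$ is an $S$-glued system.
   Context: A partially ordered set is of finite length if every chain in it is finite. $S$ has order $\le$, join $\vee$ and meet $\wedge$, and $x\prec y$ means $y$ covers $x$. Partial maps: for $x\le y$, each $\phi_{yx}$ is a partial map from $L_x$ to $L_y$ that is a bijection from its domain $\operatorname{dom}\phi_{yx}\subseteq L_x$ onto its image $\operatorname{im}\phi_{yx}\subseteq L_y$; it may be the empty map. Composition of partial maps: $(\psi\circ\phi)(a)$ is defined if and only if $\phi(a)$ is defined and $\psi$ is defined at $\phi(a)$. $S$-connected system: the system is $S$-connected if for all $x,y\in S$: (17) if $x\le y$ and $\phi_{yx}\ne\emptyset$, then $\phi_{yx}$ is a lattice isomorphism from a filter of $L_x$ onto an ideal of $L_y$; moreover $\phi_{xx}$ is the identity of $L_x$; (18) if $x\prec y$, then $\phi_{yx}\ne\emptyset$; (19) if $x\le z\le y$, then $\phi_{yx}=\phi_{yz}\circ\phi_{zx}$; (20) $\operatorname{im}\phi_{(x\vee y)x}\cap\operatorname{im}\phi_{(x\vee y)y}\subseteq\operatorname{im}\phi_{(x\vee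 y)(x\wedge y)}$; (20$^\delta$) $\operatorname{dom}\phi_{x(x\wedge y)}\cap\operatorname{dom}\phi_{y(x\wedge y)}\subseteq\operatorname{dom}\phi_{(x\vee y)(x\wedge y)}$. Quotient construction: let $K=\{(x,a):x\in S,\ a\in L_x\}$ be the disjoint union of the $L_x$. Define $(x,a)\sim(y,b)$ if there is $z\in S$ with $z\ge x$, $z\ge y$, $a\in\operatorname{dom}\phi_{zx}$, $b\in\operatorname{dom}\phi_{zy}$ and $\phi_{zx}(a)=\phi_{zy}(b)$; this is an equivalence relation on $K$. Let $\pi:K\to K/{\sim}$ be the canonical projection and $\pi_x(a)=\pi(x,a)$ for $a\in L_x$. $S$-glued system: a family $(L'_x)_{x\in S}$ of finite-length lattices (sets possibly overlapping, orders $\le_x$) is an $S$-glued system if for all $x,y$: (1) if $x\le y$ and $L'_x\cap L'_y\neq\emptyset$, then $L'_x\cap L'_y$ is a filter of $L'_x$ and an ideal of $L'_y$; (2) if $x\le y$, then $a\le_x b\iff a\le_y b$ for $a,b\in L'_x\cap L'_y$; (3) $x\prec y$ implies $L'_x\cap L'_y\ne\emptyset$; (4) $L'_x\cap L'_y\subseteq L'_{x\wedge y}\cap L'_{x\vee y}$. A filter is a nonempty up-closed subset closed under meets; an ideal is the dual notion. -}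

module Defs where

open import Level using (0ℓ)
open import Data.Product using (Σ; ∃; ∃-syntax; _×_; _,_)
open import Data.Sum using (_⊎_)
open import Data.List using (List)
open import Data.List.Membership.Propositional using (_∈_)
open import Data.Maybe using (Maybe; just; _>>=_)
open import Relation.Nullary using (¬_)
open import Relation.Unary using (Pred)
open import Relation.Binary.Core using (Rel)
open import Relation.Binary.PropositionalEquality using (_≡_; _≢_)
open import Relation.Binary.Lattice.Structures using (IsLattice)
open import Algebra.Core using (Op₂)

record Lat : Set₁ where
  field
    Carrier   : Set
    _≤_       : Rel Carrier 0ℓ
    _∨_       : Op₂ Carrier
    _∧_       : Op₂ Carrier
    isLattice : IsLattice _≡_ _≤_ _∨_ _∧_

open Lat public using (Carrier)

module _ (P : Lat) where
  open Lat P hiding (Carrier)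

  _<ₗ_ : Rel (Carrier P) 0ℓ
  x <ₗ y = x ≤ y × x ≢ y

  Covers : Carrier P → Carrier P → Set
  Covers x y = x <ₗ y × ¬ (∃[ z ] (x <ₗ z × z <ₗ y))

  IsChain : Pred (Carrier P) 0ℓ → Set
  IsChain C = ∀ {a b} → C a → C b → a ≤ b ⊎ b ≤ a

  IsFiniteSubset : Pred (Carrier P) 0ℓ → Set
  IsFiniteSubset C = ∃[ xs ] (∀ {a} → C a → a ∈ xs)

  FiniteLength : Set₁
  FiniteLength = (C : Pred (Carrier P) 0ℓ) → IsChain C → IsFiniteSubset C

  record IsFilter (F : Pred (Carrier P) 0ℓ) : Set where
    field
      nonempty : ∃[ a ] F a
      upClosed : ∀ {a b} → F a → a ≤ b → F b
      meetClosed : ∀ {a b} → F a → F b → F (a ∧ b)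

  record IsIdeal (I : Pred (Carrier P) 0ℓ) : Set where
    field
      nonempty : ∃[ a ] I a
      downClosed : ∀ {a b} → I b → a ≤ b → I a
      joinClosed : ∀ {a b} → I a → I b → I (a ∨ b)

-- Systems of partial maps.  A partial map L_x ⇀ L_y is a function
-- L_x → Maybe L_y; φ y x is φ_{yx} (only used for x ≤ y).

module System (S : Lat) (L : Carrier S → Lat)
              (φ : (y x : Carrier S) → Carrier (L x) → Maybe (Carrier (L y))) where
  open Lat S hiding (Carrier) renaming (_≤_ to _≤S_; _∨_ to _∨S_; _∧_ to _∧S_)
  private
    join : ∀ x → Op₂ (Carrier (L x))
    join x = Lat._∨_ (L x)
    meet : ∀ x → Op₂ (Carrier (L x))
    meet x = Lat._∧_ (L x)

  dom : (y x : Carrier S) → Pred (Carrier (L x)) 0ℓ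
  dom y x a = ∃[ c ] (φ y x a ≡ just c)

  im : (y x : Carrier S) → Pred (Carrier (L y)) 0ℓ
  im y x c = ∃[ a ] (φ y x a ≡ just c)

  -- standing assumption: each φ_{yx} (x ≤ y) is a bijection from its
  -- domain onto its image, i.e. injective on its domain
  PartialBijections : Set
  PartialBijections = ∀ {x y} → x ≤S y → ∀ {a b c} →
    φ y x a ≡ just c → φ y x b ≡ just c → a ≡ b

  IsFilterIdealIso : (y x : Carrier S) → Set
  IsFilterIdealIso y x =
    IsFilter (L x) (dom y x) × IsIdeal (L y) (im y x) ×
    (∀ {a b c d} → φ y x a ≡ just c → φ y x b ≡ just d →
       φ y x (meet x a b) ≡ just (meet y c d) ×
       φ y x (join x a b) ≡ just (join y c d))

  record SConnected : Set where
    field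
      c17  : ∀ {x y} → x ≤S y → (∃[ a ] dom y x a) → IsFilterIdealIso y x
      c17id : ∀ x a → φ x x a ≡ just a
      c18  : ∀ {x y} → Covers S x y → ∃[ a ] dom y x a
      c19  : ∀ {x y z} → x ≤S z → z ≤S y → ∀ a → φ y x a ≡ (φ z x a >>= φ y z)
      c20  : ∀ x y c → im (x ∨S y) x c → im (x ∨S y) y c → im (x ∨S y) (x ∧S y) c
      c20δ : ∀ x y a → dom x (x ∧S y) a → dom y (x ∧S y) a → dom (x ∨S y) (x ∧S y) a

  K : Set
  K = Σ (Carrier S) (λ x → Carrier (L x))

  _∼_ : Rel K 0ℓ
  (x , a) ∼ (y , b) = ∃[ z ] (x ≤S z × y ≤S z × ∃[ c ] (φ z x a ≡ just c × φ z y b ≡ just c))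

  -- π_x (the quotient K/∼ is represented by the setoid (K, ∼))
  π : (x : Carrier S) → Carrier (L x) → K
  π x a = (x , a)

  -- L^π_x = π_x(L_x) as a (∼-saturated) subset of K/∼
  Lπ : (x : Carrier S) → Pred K 0ℓ
  Lπ x k = ∃[ a ] (k ∼ π x a)

  _≤[_]_ : K → Carrier S → K → Set
  k ≤[ x ] k' = ∃[ a ] ∃[ b ] (k ∼ π x a × k' ∼ π x b × Lat._≤_ (L x) a b)

  -- π_x : L_x → L^π_x is a lattice isomorphism (structure on L^π_x being
  -- transported along π_x): π_x is injective and reflects/preserves order
  PiIso : Set
  PiIso = ∀ x → (∀ a b → π x a ∼ π x b → a ≡ b) ×
                (∀ a b → (π x a ≤[ x ] π x b → Lat._≤_ (L x) a b) ×
                         (Lat._≤_ (L x) a b → π x a ≤[ x ] π x b))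

  -- (L^π_x)_{x∈S} is an S-glued system (lattice structure of L^π_x
  -- transported from L_x along π_x; a subset F of L^π_x is a filter iff
  -- its preimage under π_x is a filter of L_x, etc.)
  record SGlued : Set where
    field
      g1 : ∀ {x y} → x ≤S y → (∃[ k ] (Lπ x k × Lπ y k)) →
             IsFilter (L x) (λ a → Lπ y (π x a)) × IsIdeal (L y) (λ b → Lπ x (π y b))
      g2 : ∀ {x y} → x ≤S y → ∀ {k k'} → Lπ x k → Lπ y k → Lπ x k' → Lπ y k' →
             (k ≤[ x ] k' → k ≤[ y ] k') × (k ≤[ y ] k' → k ≤[ x ] k')
      g3 : ∀ {x y} → Covers S x y → ∃[ k ] (Lπ x k × Lπ y k)
      g4 : ∀ {x y k} → Lπ x k → Lπ y k → Lπ (x ∧S y) k × Lπ (x ∨S y) k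

{-# OPTIONS --safe #-}
module Submission where

-- By (19) the maps φ compose, so two elements identified at an upper bound z
-- have the same image (or none) at every z' ≥ z, and, the maps being injective,
-- are identified at every upper bound below z, in particular at x ∨ y.
-- Transitivity of ∼ needs an upper bound at which the middle element is still
-- defined; (20^δ) supplies one at the join of the two witnesses.  Once (x , a) ∼ (y , b) is known to mean
-- φ_{yx}(a) = b for x ≤ y, each glued-system axiom is a connectedness axiom in
-- disguise: (17) gives (1) and (2), (18) gives (3), and (20) gives the
-- meet half of (4).

open import Defs
open import Level using (0ℓ)
open import Data.Product using (_×_; ∃-syntax; _,_; proj₁)
open import Data.Maybe using (Maybe; just; _>>=_)
open import Data.Maybe.Properties using (just-injective)
open import Function.Bundles using (_⇔_; mk⇔; Equivalence)
import Function.Properties.Equivalence as ⇔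
open import Axiom.ExcludedMiddle using (ExcludedMiddle)
open import Relation.Unary using (Pred; _≐_)
open import Relation.Binary.Structures using (IsEquivalence)
open import Relation.Binary.PropositionalEquality
  using (_≡_; refl; sym; trans; cong; subst; subst₂; module ≡-Reasoning)
open import Relation.Binary.Lattice.Structures using (IsLattice)
open import Relation.Binary.Lattice.Bundles using (Lattice)
import Relation.Binary.Lattice.Properties.MeetSemilattice as MeetSemilatticeProperties

open Equivalence using (to; from)

>>=-just : ∀ {A B : Set} (m : Maybe A) {f : A → Maybe B} {c : B} →
           (m >>= f) ≡ just c → ∃[ b ] (m ≡ just b × f b ≡ just c)
>>=-just (just b) e = b , refl , e

module _ (P : Lat) where
  open Lat P hiding (Carrier)

  asLattice : Lattice 0ℓ 0ℓ 0ℓ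
  asLattice = record { _≈_ = _≡_ ; isLattice = isLattice }

  open Lattice asLattice using (x∧y≤x)

  ≤⇔∧≡ : ∀ {a b} → a ≤ b ⇔ b ∧ a ≡ a
  ≤⇔∧≡ {a} {b} = mk⇔ (MeetSemilatticeProperties.y≤x⇒x∧y≈y (Lattice.meetSemilattice asLattice))
                      (λ e → subst (_≤ b) e (x∧y≤x b a))

  module _ {A B : Pred (Carrier P) 0ℓ} where

    isFilter-resp-≐ : A ≐ B → IsFilter P A → IsFilter P B
    isFilter-resp-≐ (A⊆B , B⊆A) F = record
      { nonempty   = let a , Aa = nonempty in a , A⊆B Aa
      ; upClosed   = λ Ba a≤b → A⊆B (upClosed (B⊆A Ba) a≤b)
      ; meetClosed = λ Ba Bb → A⊆B (meetClosed (B⊆A Ba) (B⊆A Bb))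
      } where open IsFilter F

    isIdeal-resp-≐ : A ≐ B → IsIdeal P A → IsIdeal P B
    isIdeal-resp-≐ (A⊆B , B⊆A) I = record
      { nonempty   = let a , Aa = nonempty in a , A⊆B Aa
      ; downClosed = λ Bb a≤b → A⊆B (downClosed (B⊆A Bb) a≤b)
      ; joinClosed = λ Ba Bb → A⊆B (joinClosed (B⊆A Ba) (B⊆A Bb))
      } where open IsIdeal I

module PartialMap (P Q : Lat) (f : Carrier P → Maybe (Carrier Q)) where
  open Lat P using () renaming (_≤_ to _≤P_; _∧_ to _∧P_)
  open Lat Q using () renaming (_≤_ to _≤Q_; _∧_ to _∧Q_)

  InjectiveOnDom : Set
  InjectiveOnDom = ∀ {a b c} → f a ≡ just c → f b ≡ just c → a ≡ b

  PreservesMeets : Set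
  PreservesMeets = ∀ {a b c d} → f a ≡ just c → f b ≡ just d → f (a ∧P b) ≡ just (c ∧Q d)

  ≤⇔≤ : InjectiveOnDom → PreservesMeets →
        ∀ {a b c d} → f a ≡ just c → f b ≡ just d → a ≤P b ⇔ c ≤Q d
  ≤⇔≤ injective ∧-homo {a} {b} {c} {d} fa fb = mk⇔ ≤-mono ≤-reflect
    where
      ≤-mono : a ≤P b → c ≤Q d
      ≤-mono a≤b = from (≤⇔∧≡ Q) (just-injective (begin
        just (d ∧Q c)  ≡⟨ sym (∧-homo fb fa) ⟩
        f (b ∧P a)     ≡⟨ cong f (to (≤⇔∧≡ P) a≤b) ⟩
        f a            ≡⟨ fa ⟩
        just c         ∎))
        where open ≡-Reasoning
      ≤-reflect : c ≤Q d → a ≤P b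
      ≤-reflect c≤d = from (≤⇔∧≡ P)
        (injective (trans (∧-homo fb fa) (cong just (to (≤⇔∧≡ Q) c≤d))) fa)

module SConnectedSystem (S : Lat) (L : Carrier S → Lat)
                        (φ : (y x : Carrier S) → Carrier (L x) → Maybe (Carrier (L y)))
                        (injective : System.PartialBijections S L φ)
                        (connected : System.SConnected S L φ) where
  open System S L φ
  open SConnected connected
  open Lat S using () renaming (_≤_ to _≤S_; _∨_ to _∨S_; _∧_ to _∧S_)
  open IsLattice (Lat.isLattice S)
    using (x≤x∨y; y≤x∨y; x∧y≤x; x∧y≤y; ∨-least; ∧-greatest)
    renaming (refl to ≤S-refl; trans to ≤S-trans)

  φ-factor : ∀ {x y z a c} → x ≤S z → z ≤S y → φ y x a ≡ just c →
             ∃[ b ] (φ z x a ≡ just b × φ y z b ≡ just c)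
  φ-factor {x} {y} {z} {a} x≤z z≤y e = >>=-just (φ z x a) (trans (sym (c19 x≤z z≤y a)) e)

  φ-compose : ∀ {x y z a b c} → x ≤S z → z ≤S y → φ z x a ≡ just b → φ y z b ≡ just c →
              φ y x a ≡ just c
  φ-compose {x} {y} {z} {a} x≤z z≤y ea eb = trans (c19 x≤z z≤y a) (trans (cong (_>>= φ y z) ea) eb)

  φ-agree-above : ∀ {x y z w a b c} → x ≤S z → y ≤S z → z ≤S w →
                  φ z x a ≡ just c → φ z y b ≡ just c → φ w x a ≡ φ w y b
  φ-agree-above {x} {y} {z} {w} {a} {b} x≤z y≤z z≤w ea eb = begin
    φ w x a              ≡⟨ c19 x≤z z≤w a ⟩
    (φ z x a >>= φ w z)  ≡⟨ cong (_>>= φ w z) (trans ea (sym eb)) ⟩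
    (φ z y b >>= φ w z)  ≡⟨ sym (c19 y≤z z≤w b) ⟩
    φ w y b              ∎
    where open ≡-Reasoning

  φ-agree-below : ∀ {x y z w a b c} → x ≤S w → y ≤S w → w ≤S z →
                  φ z x a ≡ just c → φ z y b ≡ just c →
                  ∃[ d ] (φ w x a ≡ just d × φ w y b ≡ just d)
  φ-agree-below x≤w y≤w w≤z ea eb
    with φ-factor x≤w w≤z ea | φ-factor y≤w w≤z eb
  ... | d , ead , edc | d′ , ebd′ , ed′c with injective w≤z edc ed′c
  ... | refl = d , ead , ebd′

  dom-∨ : ∀ {y u v b} → y ≤S u → y ≤S v → dom u y b → dom v y b → dom (u ∨S v) y b
  dom-∨ {y} {u} {v} y≤u y≤v (c , ec) (c′ , ec′)
    with φ-factor (∧-greatest y≤u y≤v) (x∧y≤x u v) ec | φ-factor (∧-greatest y≤u y≤v) (x∧y≤y u v) ec′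
  ... | d , ed , edc | d′ , ed′ , ed′c′ with just-injective (trans (sym ed) ed′)
  ... | refl with c20δ u v d (c , edc) (c′ , ed′c′)
  ... | h , eh = h , φ-compose (∧-greatest y≤u y≤v) (≤S-trans (x∧y≤x u v) (x≤x∨y u v)) ed eh

  ∼-isEquivalence : IsEquivalence _∼_
  ∼-isEquivalence = record
    { refl  = λ { {x , a} → x , ≤S-refl , ≤S-refl , a , c17id x a , c17id x a }
    ; sym   = λ (z , x≤z , y≤z , c , ea , eb) → z , y≤z , x≤z , c , eb , ea
    ; trans = ∼-trans
    }
    where
      ∼-trans : ∀ {i j k} → i ∼ j → j ∼ k → i ∼ k
      ∼-trans (z , x≤z , y≤z , c , ea , eb) (z′ , y≤z′ , w≤z′ , c′ , eb′ , ew)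
        with dom-∨ y≤z y≤z′ (c , eb) (c′ , eb′)
      ... | h , eh =
        z ∨S z′ , ≤S-trans x≤z (x≤x∨y z z′) , ≤S-trans w≤z′ (y≤x∨y z z′) , h ,
        trans (φ-agree-above x≤z y≤z (x≤x∨y z z′) ea eb) eh ,
        trans (sym (φ-agree-above y≤z′ w≤z′ (y≤x∨y z z′) eb′ ew)) eh

  open IsEquivalence ∼-isEquivalence using ()
    renaming (refl to ∼-refl; sym to ∼-sym; trans to ∼-trans)

  ∼⇔φ : ∀ {x y a b} → x ≤S y → π x a ∼ π y b ⇔ φ y x a ≡ just b
  ∼⇔φ {y = y} {b = b} x≤y = mk⇔
    (λ (z , x≤z , y≤z , c , ea , eb) →
       let d , ead , ebd = φ-agree-below x≤y ≤S-refl y≤z ea eb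
       in trans ead (trans (sym ebd) (c17id y b)))
    (λ e → y , x≤y , ≤S-refl , b , e , c17id y b)

  ∼-at-∨ : ∀ {x y a b} → π x a ∼ π y b →
           ∃[ c ] (φ (x ∨S y) x a ≡ just c × φ (x ∨S y) y b ≡ just c)
  ∼-at-∨ {x} {y} (z , x≤z , y≤z , c , ea , eb) =
    φ-agree-below (x≤x∨y x y) (y≤x∨y x y) (∨-least x≤z y≤z) ea eb

  φ-on-overlap : ∀ {x y k a b} → x ≤S y → k ∼ π x a → k ∼ π y b → φ y x a ≡ just b
  φ-on-overlap x≤y ka kb = to (∼⇔φ x≤y) (∼-trans (∼-sym ka) kb)

  π-injective : ∀ {x a b} → π x a ∼ π x b → a ≡ b
  π-injective (z , x≤z , _ , c , ea , eb) = injective x≤z ea eb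

  ≤[]⇔≤ : ∀ {x k k′ a b} → k ∼ π x a → k′ ∼ π x b → k ≤[ x ] k′ ⇔ Lat._≤_ (L x) a b
  ≤[]⇔≤ {a = a} {b} ka kb = mk⇔
    (λ (a′ , b′ , ka′ , kb′ , a′≤b′) →
       subst₂ (Lat._≤_ (L _)) (π-injective (∼-trans (∼-sym ka′) ka))
                               (π-injective (∼-trans (∼-sym kb′) kb)) a′≤b′)
    (λ a≤b → a , b , ka , kb , a≤b)

  dom≐Lπ : ∀ {x y} → x ≤S y → dom y x ≐ (λ a → Lπ y (π x a))
  dom≐Lπ x≤y = (λ (b , e) → b , from (∼⇔φ x≤y) e)
             , (λ (b , s) → b , to (∼⇔φ x≤y) s)

  im≐Lπ : ∀ {x y} → x ≤S y → im y x ≐ (λ b → Lπ x (π y b))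
  im≐Lπ x≤y = (λ (a , e) → a , ∼-sym (from (∼⇔φ x≤y) e))
            , (λ (a , s) → a , to (∼⇔φ x≤y) (∼-sym s))

  π-iso : PiIso
  π-iso x = (λ a b → π-injective) , λ a b → let e = ≤[]⇔≤ ∼-refl ∼-refl in to e , from e

  overlap-filter-ideal : ∀ {x y} → x ≤S y → ∃[ k ] (Lπ x k × Lπ y k) →
    IsFilter (L x) (λ a → Lπ y (π x a)) × IsIdeal (L y) (λ b → Lπ x (π y b))
  overlap-filter-ideal x≤y (k , (a , ka) , (b , kb))
    with c17 x≤y (a , b , φ-on-overlap x≤y ka kb)
  ... | isFilter , isIdeal , _ =
    isFilter-resp-≐ (L _) (dom≐Lπ x≤y) isFilter , isIdeal-resp-≐ (L _) (im≐Lπ x≤y) isIdeal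

  overlap-≤-agree : ∀ {x y} → x ≤S y → ∀ {k k′} → Lπ x k → Lπ y k → Lπ x k′ → Lπ y k′ →
                    k ≤[ x ] k′ ⇔ k ≤[ y ] k′
  overlap-≤-agree {x} {y} x≤y (a , ka) (a′ , ka′) (b , kb) (b′ , kb′) =
    ⇔.trans (≤[]⇔≤ ka kb) (⇔.trans (≤⇔≤ (injective x≤y) ∧-homo ea eb) (⇔.sym (≤[]⇔≤ ka′ kb′)))
    where
      open PartialMap (L x) (L y) (φ y x)
      ea : φ y x a ≡ just a′
      ea = φ-on-overlap x≤y ka ka′
      eb : φ y x b ≡ just b′
      eb = φ-on-overlap x≤y kb kb′
      ∧-homo : PreservesMeets
      ∧-homo fa fb = let _ , _ , homo = c17 x≤y (a , a′ , ea) in proj₁ (homo fa fb)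

  covering-overlap : ∀ {x y} → Covers S x y → ∃[ k ] (Lπ x k × Lπ y k)
  covering-overlap x⋖y@((x≤y , _) , _) with c18 x⋖y
  ... | a , b , e = π _ a , (a , ∼-refl) , (b , from (∼⇔φ x≤y) e)

  overlap-∧-∨ : ∀ {x y k} → Lπ x k → Lπ y k → Lπ (x ∧S y) k × Lπ (x ∨S y) k
  overlap-∧-∨ {x} {y} (a , ka) (b , kb) with ∼-at-∨ (∼-trans (∼-sym ka) kb)
  ... | c , ea , eb with c20 x y c (a , ea) (b , eb)
  ... | d , ed =
      (d , ∼-trans ka (x ∨S y , x≤x∨y x y , ≤S-trans (x∧y≤x x y) (x≤x∨y x y) , c , ea , ed))
    , (c , ∼-trans ka (from (∼⇔φ (x≤x∨y x y)) ea))

theorem4p2 : ExcludedMiddle 0ℓ →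
    (S : Lat) → FiniteLength S →
    (L : Carrier S → Lat) → (∀ x → FiniteLength (L x)) →
    (φ : (y x : Carrier S) → Carrier (L x) → Maybe (Carrier (L y))) →
    System.PartialBijections S L φ →
    System.SConnected S L φ →
    System.PiIso S L φ × System.SGlued S L φ
theorem4p2 _ S _ L _ φ injective connected = π-iso , record
  { g1 = overlap-filter-ideal
  ; g2 = λ x≤y kx ky k′x k′y → let e = overlap-≤-agree x≤y kx ky k′x k′y in to e , from e
  ; g3 = covering-overlap
  ; g4 = overlap-∧-∨
  }
  where open SConnectedSystem S L φ injective connected
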